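{- Fix an integer $c\ge 2$. There exists $K$ such that for every integer $k\ge K$, putting $x=p_{c(k-1)}-1$ (where $p_m$ is the $m$-th prime, $p_1=2$), there is a coloring of $\{1,\ldots,x\}$ with $c$ colors in which every color class has size $\lfloor x/c\rfloor$ or $\lceil x/c\rceil$ and no color class contains $k$ pairwise coprime integers. Consequently, if $L_{\mathrm{bal}}(k;c)$ denotes the largest $n$ admitting a $c$-coloring of $\{1,\ldots,n\}$ with all color class sizes in $\{\lfloor n/c\rfloor,\lceil n/c\rceil\}$ and no color class containing $k$ pairwise coprime integers, then $L_{\mathrm{bal}}(k;c)=p_{c(k-1)}-1$ for all sufficiently large $k$.
   Context: A set of pairwise coprime integers means a set of distinct positive integers any two of which have greatest common divisor $1$. -}

module Defs where

open import Data.Nat using (ℕ; zero; suc; _+_; _*_; _∸_; _≤_; NonZero; _!)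
open import Data.Nat.DivMod using (_/_)
open import Data.Nat.Primality using (Prime; prime?)
open import Data.Nat.Coprimality using (Coprime)

open import Data.Fin using (Fin)
open import Data.Fin.Properties using () renaming (_≟_ to _≟ᶠ_)
open import Data.List using (List; length; filter; upTo; map)
open import Data.List.Relation.Unary.All using (All)
open import Data.List.Relation.Unary.AllPairs using (AllPairs)
open import Data.Product using (Σ; _×_)
open import Data.Sum using (_⊎_)
open import Relation.Nullary using (¬_; yes; no)
open import Relation.Binary.PropositionalEquality using (_≡_; _≢_)

-- First prime among s, s+1, ..., s+fuel (returns junk if none; never
-- happens for the use below).
firstPrimeFrom : ℕ → ℕ → ℕ
firstPrimeFrom zero    s = s
firstPrimeFrom (suc f) s with prime? s
... | yes _ = s
... | no  _ = firstPrimeFrom f (suc s)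

-- Least prime > n (by Euclid, there is one in (n, n! + 1]).
nextPrime : ℕ → ℕ
nextPrime n = firstPrimeFrom (n !) (suc n)

-- p m = the m-th prime, p 1 = 2, p 2 = 3, ...  (p 0 = 1 is a convention).
p : ℕ → ℕ
p zero    = 1
p (suc m) = nextPrime (p m)

⌈_/_⌉ : (n c : ℕ) → .{{NonZero c}} → ℕ
⌈ n / c ⌉ = (n + (c ∸ 1)) / c

oneTo : ℕ → List ℕ
oneTo n = map suc (upTo n)

classSize : ∀ {c} → (ℕ → Fin c) → ℕ → Fin c → ℕ
classSize col n j = length (filter (λ i → col i ≟ᶠ j) (oneTo n))

Balanced : (c : ℕ) → .{{NonZero c}} → (n : ℕ) → (ℕ → Fin c) → Set
Balanced c n col = ∀ (j : Fin c) → (classSize col n j ≡ n / c) ⊎ (classSize col n j ≡ ⌈ n / c ⌉)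

ClassHasCoprimeK : ∀ {c} → (ℕ → Fin c) → ℕ → Fin c → ℕ → Set
ClassHasCoprimeK col n j k =
  Σ (List ℕ) λ xs → (length xs ≡ k)
    × All (λ a → (1 ≤ a) × (a ≤ n) × (col a ≡ j)) xs
    × AllPairs (λ a b → (a ≢ b) × Coprime a b) xs

AdmitsBal : (k c : ℕ) → .{{NonZero c}} → (n : ℕ) → Set
AdmitsBal k c n = Σ (ℕ → Fin c) λ col →
  Balanced c n col × (∀ (j : Fin c) → ¬ ClassHasCoprimeK col n j k)

-- Call 1 and the primes slots. Distinct slots are coprime, and {1, …, n} contains 1 + π(n) of
-- them, so once n ≥ p_M (M = c(k − 1)) some colour class contains k of them: this is the upper
-- bound. Conversely {1, …, p_M − 1} contains exactly M slots; hand k − 1 of them to each colour and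
-- give every number the colour of a slot dividing it. Distinct pairwise coprime members of a
-- class then divide distinct slots of that class, so no class contains k of them.
--   To make the classes balanced, reserve for colour j a hub of primes (b_j, b_{j+1}], so large
-- (∑ 1/q diverges) that only a fraction 1/(2c²) of all integers avoids it; the hub's slots get
-- colour j. A number divisible by a prime of every hub may then take any colour, and there are so
-- many of these that they can even out the class sizes. K is chosen so that the hubs and their
-- products are small compared with k.
module Submission where

open import Defs
open import Data.Empty using (⊥; ⊥-elim)
open import Data.Fin using (Fin; zero; suc; toℕ)
open import Data.Fin.Properties using (toℕ<n; ¬∀⟶∃¬) renaming (_≟_ to _≟ᶠ_; all? to allᶠ?)
import Data.Fin.Properties as Fin
open import Data.List using (List; []; _∷_; length; filter; upTo; map; take; _++_; [_])
open import Data.List.Membership.Propositional using (_∈_)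
open import Data.List.Membership.Propositional.Properties using (∈-map⁺; ∈-upTo⁺; ∈-filter⁺)
open import Data.List.Properties using (length-++; filter-++; map-++; applyUpTo-∷ʳ; length-take; length-map)
open import Data.List.Relation.Unary.All using (All; []; _∷_; all?)
import Data.List.Relation.Unary.All as All
open import Data.List.Relation.Unary.All.Properties using (all-filter; applyUpTo⁺₁)
  renaming (filter⁺ to All-filter⁺; map⁺ to All-map⁺; take⁺ to All-take⁺)
open import Data.List.Relation.Unary.AllPairs using (AllPairs; []; _∷_)
open import Data.List.Relation.Unary.Unique.Propositional using (Unique)
open import Data.List.Relation.Unary.Unique.Propositional.Properties using (upTo⁺)
  renaming (filter⁺ to Unique-filter⁺; map⁺ to Unique-map⁺; take⁺ to Unique-take⁺)
open import Data.Nat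
open import Data.Nat.Coprimality using (Coprime; coprime-divisor)
open import Data.Nat.Divisibility
open import Data.Nat.DivMod
open import Data.Nat.ListAction using (product)
open import Data.Nat.ListAction.Properties using (∈⇒∣product)
open import Data.Nat.Primality
open import Data.Nat.Primality.Factorisation using (factorise)
open import Data.Nat.Properties
open import Data.Nat.Solver using (module +-*-Solver)
open import Data.Product using (Σ; _×_; _,_; proj₁; proj₂; ∃)
open import Data.Sum using (_⊎_; inj₁; inj₂)
open import Function using (_∘_)
open import Level using (0ℓ)
open import Relation.Binary.PropositionalEquality hiding ([_])
open import Relation.Nullary using (¬_; Dec; yes; no; ¬?; _×-dec_; _⊎-dec_)
open import Relation.Nullary.Decidable using (decidable-stable)
open import Relation.Unary using (Pred; Decidable; _∩_; ∁)
open import Relation.Unary.Properties using (_∩?_; _∪?_; ∁?)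

open +-*-Solver using (solve; _:=_; _:+_; _:*_; con)
open import Algebra.Properties.CommutativeSemigroup +-commutativeSemigroup using (interchange; x∙yz≈y∙xz; xy∙z≈xz∙y)
open import Algebra.Properties.Semiring.Sum +-*-semiring using (sum; ∑-distrib-+; sum-cong-≗; *-distribʳ-sum; *-distribˡ-sum)

-- Counting on {1, …, n}

χ : {A : Set} → Dec A → ℕ
χ (yes _) = 1
χ (no _)  = 0

χ≤1 : {A : Set} (a? : Dec A) → χ a? ≤ 1
χ≤1 (yes _) = s≤s z≤n
χ≤1 (no _)  = z≤n

χ-yes : {A : Set} (a? : Dec A) → A → χ a? ≡ 1
χ-yes (yes _) a = refl
χ-yes (no ¬a) a = ⊥-elim (¬a a)

χ-no : {A : Set} (a? : Dec A) → ¬ A → χ a? ≡ 0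
χ-no (yes a) ¬a = ⊥-elim (¬a a)
χ-no (no _)  ¬a = refl

χ-mono : {A B : Set} (a? : Dec A) (b? : Dec B) → (A → B) → χ a? ≤ χ b?
χ-mono (yes a) (yes _) A→B = ≤-refl
χ-mono (yes a) (no ¬b) A→B = ⊥-elim (¬b (A→B a))
χ-mono (no _)  _       A→B = z≤n

χ-cong : {A B : Set} (a? : Dec A) (b? : Dec B) → (A → B) → (B → A) → χ a? ≡ χ b?
χ-cong a? b? A→B B→A = ≤-antisym (χ-mono a? b? A→B) (χ-mono b? a? B→A)

χ-∩∁ : {A B : Set} (a? : Dec A) (b? : Dec B) → χ a? ≡ χ (a? ×-dec b?) + χ (a? ×-dec ¬? b?)
χ-∩∁ (yes _) (yes _) = refl
χ-∩∁ (yes _) (no _)  = refl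
χ-∩∁ (no _)  _       = refl

χ-∪ : {A B : Set} (a? : Dec A) (b? : Dec B) → (A → ¬ B) → χ (a? ⊎-dec b?) ≡ χ a? + χ b?
χ-∪ (yes a) (yes b) A→¬B = ⊥-elim (A→¬B a b)
χ-∪ (yes _) (no _)  A→¬B = refl
χ-∪ (no _)  (yes _) A→¬B = refl
χ-∪ (no _)  (no _)  A→¬B = refl

count : {P : Pred ℕ 0ℓ} → Decidable P → ℕ → ℕ
count P? zero    = 0
count P? (suc n) = χ (P? (suc n)) + count P? n

module _ {P : Pred ℕ 0ℓ} (P? : Decidable P) where

  count≤ : ∀ n → count P? n ≤ n
  count≤ zero    = z≤n
  count≤ (suc n) = +-mono-≤ (χ≤1 (P? (suc n))) (count≤ n)

  count-monoʳ-≤ : ∀ {m n} → m ≤ n → count P? m ≤ count P? n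
  count-monoʳ-≤ {n = zero}  z≤n = ≤-refl
  count-monoʳ-≤ {m} {suc n} m≤1+n with m ≟ suc n
  ... | yes refl = ≤-refl
  ... | no m≢1+n = ≤-trans (count-monoʳ-≤ (≤-pred (≤∧≢⇒< m≤1+n m≢1+n))) (m≤n+m _ _)

  count-all : ∀ n → (∀ i → 1 ≤ i → i ≤ n → P i) → count P? n ≡ n
  count-all zero    all = refl
  count-all (suc n) all =
    cong₂ _+_ (χ-yes (P? (suc n)) (all (suc n) (s≤s z≤n) ≤-refl))
              (count-all n (λ i 1≤i i≤n → all i 1≤i (m≤n⇒m≤1+n i≤n)))

  count-none : ∀ n → (∀ i → 1 ≤ i → i ≤ n → ¬ P i) → count P? n ≡ 0
  count-none zero    none = refl
  count-none (suc n) none =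
    cong₂ _+_ (χ-no (P? (suc n)) (none (suc n) (s≤s z≤n) ≤-refl))
              (count-none n (λ i 1≤i i≤n → none i 1≤i (m≤n⇒m≤1+n i≤n)))

  shift? : ∀ a → Decidable (λ i → P (a + i))
  shift? a i = P? (a + i)

  count-+ : ∀ a b → count P? (a + b) ≡ count P? a + count (shift? a) b
  count-+ a zero    = trans (cong (count P?) (+-identityʳ a)) (sym (+-identityʳ _))
  count-+ a (suc b) = begin
    count P? (a + suc b)                                        ≡⟨ cong (count P?) (+-suc a b) ⟩
    χ (P? (suc (a + b))) + count P? (a + b)                     ≡⟨ cong₂ _+_ (cong (χ ∘ P?) (sym (+-suc a b))) (count-+ a b) ⟩
    χ (P? (a + suc b)) + (count P? a + count (shift? a) b)  ≡⟨ x∙yz≈y∙xz (χ (P? (a + suc b))) (count P? a) _ ⟩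
    count P? a + count (shift? a) (suc b)                  ∎
    where open ≡-Reasoning

  count-gap : ∀ {a b} → a ≤ b → (∀ i → a < i → i ≤ b → ¬ P i) → count P? b ≡ count P? a
  count-gap {a} {zero}  z≤n   gap = refl
  count-gap {a} {suc b} a≤1+b gap with a ≟ suc b
  ... | yes refl = refl
  ... | no a≢1+b = cong₂ _+_ (χ-no (P? (suc b)) (gap (suc b) a<1+b ≤-refl))
                             (count-gap (≤-pred a<1+b) (λ i a<i i≤b → gap i a<i (m≤n⇒m≤1+n i≤b)))
    where a<1+b = ≤∧≢⇒< a≤1+b a≢1+b

  count-step : ∀ {a b} → a < b → (∀ i → a < i → i < b → ¬ P i) → P b → count P? b ≡ suc (count P? a)
  count-step {b = suc b} (s≤s a≤b) gap Pb =
    cong₂ _+_ (χ-yes (P? (suc b)) Pb) (count-gap a≤b (λ i a<i i≤b → gap i a<i (s≤s i≤b)))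

count-⊆ : {P Q : Pred ℕ 0ℓ} (P? : Decidable P) (Q? : Decidable Q) →
          ∀ n → (∀ i → 1 ≤ i → i ≤ n → P i → Q i) → count P? n ≤ count Q? n
count-⊆ P? Q? zero    P⊆Q = z≤n
count-⊆ P? Q? (suc n) P⊆Q =
  +-mono-≤ (χ-mono (P? (suc n)) (Q? (suc n)) (P⊆Q (suc n) (s≤s z≤n) ≤-refl))
           (count-⊆ P? Q? n (λ i 1≤i i≤n → P⊆Q i 1≤i (m≤n⇒m≤1+n i≤n)))

count-cong : {P Q : Pred ℕ 0ℓ} (P? : Decidable P) (Q? : Decidable Q) →
             ∀ n → (∀ i → 1 ≤ i → i ≤ n → P i → Q i) → (∀ i → 1 ≤ i → i ≤ n → Q i → P i) →
             count P? n ≡ count Q? n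
count-cong P? Q? n P⊆Q Q⊆P = ≤-antisym (count-⊆ P? Q? n P⊆Q) (count-⊆ Q? P? n Q⊆P)

count-∩∁ : {P Q : Pred ℕ 0ℓ} (P? : Decidable P) (Q? : Decidable Q) →
           ∀ n → count P? n ≡ count (P? ∩? Q?) n + count (P? ∩? ∁? Q?) n
count-∩∁ P? Q? zero    = refl
count-∩∁ P? Q? (suc n) = trans (cong₂ _+_ (χ-∩∁ (P? (suc n)) (Q? (suc n))) (count-∩∁ P? Q? n))
                               (interchange (χ ((P? ∩? Q?) (suc n))) _ _ _)

count-∪ : {P Q : Pred ℕ 0ℓ} (P? : Decidable P) (Q? : Decidable Q) → (∀ i → P i → ¬ Q i) →
          ∀ n → count (P? ∪? Q?) n ≡ count P? n + count Q? n
count-∪ P? Q? P⇒¬Q zero    = refl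
count-∪ P? Q? P⇒¬Q (suc n) = trans (cong₂ _+_ (χ-∪ (P? (suc n)) (Q? (suc n)) (P⇒¬Q (suc n))) (count-∪ P? Q? P⇒¬Q n))
                                   (interchange (χ (P? (suc n))) _ _ _)

count+count-∁ : {P : Pred ℕ 0ℓ} (P? : Decidable P) → ∀ n → count P? n + count (∁? P?) n ≡ n
count+count-∁ P? zero    = refl
count+count-∁ P? (suc n) = trans (interchange (χ (P? (suc n))) (count P? n) (χ (∁? P? (suc n))) _)
                                 (cong₂ _+_ (χ+χ-¬ (P? (suc n))) (count+count-∁ P? n))
  where
  χ+χ-¬ : {A : Set} (a? : Dec A) → χ a? + χ (¬? a?) ≡ 1
  χ+χ-¬ (yes _) = refl
  χ+χ-¬ (no _)  = refl

count-singleton : ∀ {a n} → 1 ≤ a → a ≤ n → count (_≟ a) n ≡ 1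
count-singleton {suc a} {n} _ 1+a≤n = begin
  count (_≟ suc a) n       ≡⟨ count-gap (_≟ suc a) 1+a≤n (λ i a<i _ i≡a → <-irrefl (sym i≡a) a<i) ⟩
  count (_≟ suc a) (suc a) ≡⟨ count-step (_≟ suc a) ≤-refl (λ i a<i i<1+a _ → <-irrefl refl (≤-trans i<1+a a<i)) refl ⟩
  suc (count (_≟ suc a) a) ≡⟨ cong suc (count-none (_≟ suc a) a (λ i _ i≤a i≡1+a → <-irrefl i≡1+a (s≤s i≤a))) ⟩
  1                        ∎
  where open ≡-Reasoning

count-remove : {P : Pred ℕ 0ℓ} (P? : Decidable P) → ∀ {a n} → 1 ≤ a → a ≤ n → P a →
               suc (count (P? ∩? ∁? (_≟ a)) n) ≡ count P? n
count-remove {P} P? {a} {n} 1≤a a≤n Pa = sym (begin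
  count P? n                                    ≡⟨ count-∩∁ P? (_≟ a) n ⟩
  count (P? ∩? (_≟ a)) n + rest                 ≡⟨ cong (_+ rest) (count-cong (P? ∩? (_≟ a)) (_≟ a) n (λ _ _ _ → proj₂) only-a) ⟩
  count (_≟ a) n + rest                         ≡⟨ cong (_+ rest) (count-singleton 1≤a a≤n) ⟩
  suc rest                                      ∎)
  where
  open ≡-Reasoning
  rest = count (P? ∩? ∁? (_≟ a)) n
  only-a : ∀ i → 1 ≤ i → i ≤ n → i ≡ a → P i × i ≡ a
  only-a i _ _ refl = Pa , refl

InRange : ℕ → Pred ℕ 0ℓ → Pred ℕ 0ℓ
InRange n P a = 1 ≤ a × a ≤ n × P a

distinct-length≤count : {P : Pred ℕ 0ℓ} (P? : Decidable P) (n : ℕ) (ys : List ℕ) →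
                        Unique ys → All (InRange n P) ys → length ys ≤ count P? n
distinct-length≤count P? n []       _              _ = z≤n
distinct-length≤count {P} P? n (a ∷ ys) (a∉ys ∷ uniq) ((1≤a , a≤n , Pa) ∷ ys∈P) =
  ≤-trans (s≤s (distinct-length≤count (P? ∩? ∁? (_≟ a)) n ys uniq (All.zipWith shrink (a∉ys , ys∈P))))
          (≤-reflexive (count-remove P? 1≤a a≤n Pa))
  where
  shrink : ∀ {b} → a ≢ b × InRange n P b → InRange n (P ∩ ∁ (_≡ a)) b
  shrink (a≢b , 1≤b , b≤n , Pb) = 1≤b , b≤n , Pb , λ b≡a → a≢b (sym b≡a)

count-rank : {R Q : Pred ℕ 0ℓ} (R? : Decidable R) (Q? : Decidable Q) →
             ∀ n → count (R? ∩? (Q? ∘ count R?)) n ≡ count Q? (count R? n)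
count-rank R? Q? zero    = refl
count-rank R? Q? (suc n) with R? (suc n)
... | yes Rn = cong₂ _+_ (χ-cong (yes Rn ×-dec Q? (suc (count R? n))) (Q? (suc (count R? n))) proj₂ (Rn ,_))
                         (count-rank R? Q? n)
... | no ¬Rn = cong₂ _+_ (χ-no (no ¬Rn ×-dec Q? (count R? n)) (¬Rn ∘ proj₁)) (count-rank R? Q? n)

oneTo-range : ∀ n → All (λ a → 1 ≤ a × a ≤ n) (oneTo n)
oneTo-range n = All-map⁺ (applyUpTo⁺₁ (λ i → i) n (λ i<n → s≤s z≤n , i<n))

∈-oneTo : ∀ {a n} → 1 ≤ a → a ≤ n → a ∈ oneTo n
∈-oneTo {suc a} _ a<n = ∈-map⁺ suc (∈-upTo⁺ a<n)

module _ {P : Pred ℕ 0ℓ} (P? : Decidable P) where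

  length-filter-oneTo : ∀ n → length (filter P? (oneTo n)) ≡ count P? n
  length-filter-oneTo zero    = refl
  length-filter-oneTo (suc n) = begin
    length (filter P? (oneTo (suc n)))                            ≡⟨ cong (length ∘ filter P?) oneTo-suc ⟩
    length (filter P? (oneTo n ++ [ suc n ]))                     ≡⟨ cong length (filter-++ P? (oneTo n) [ suc n ]) ⟩
    length (filter P? (oneTo n) ++ filter P? [ suc n ])           ≡⟨ length-++ (filter P? (oneTo n)) ⟩
    length (filter P? (oneTo n)) + length (filter P? [ suc n ])   ≡⟨ cong₂ _+_ (length-filter-oneTo n) (length-filter-singleton (suc n)) ⟩
    count P? n + χ (P? (suc n))                                   ≡⟨ +-comm (count P? n) _ ⟩
    count P? (suc n)                                              ∎
    where
    open ≡-Reasoning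
    oneTo-suc : oneTo (suc n) ≡ oneTo n ++ [ suc n ]
    oneTo-suc = trans (cong (map suc) (sym (applyUpTo-∷ʳ (λ i → i) n))) (map-++ suc (upTo n) [ n ])
    length-filter-singleton : ∀ a → length (filter P? [ a ]) ≡ χ (P? a)
    length-filter-singleton a with P? a
    ... | yes _ = refl
    ... | no _  = refl

  distinct-list-of-count : ∀ {k n} → k ≤ count P? n →
    Σ (List ℕ) λ ys → length ys ≡ k × All (InRange n P) ys × Unique ys
  distinct-list-of-count {k} {n} k≤count =
    take k ys , length-take≡k , All-take⁺ k ys∈P , Unique-take⁺ k ys-unique
    where
    ys = filter P? (oneTo n)
    ys∈P : All (InRange n P) ys
    ys∈P = All.zipWith (λ ((1≤a , a≤n) , Pa) → 1≤a , a≤n , Pa) (All-filter⁺ P? (oneTo-range n) , all-filter P? (oneTo n))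
    ys-unique : Unique ys
    ys-unique = Unique-filter⁺ P? (Unique-map⁺ suc-injective (upTo⁺ n))
    length-take≡k : length (take k ys) ≡ k
    length-take≡k = trans (length-take k ys) (m≤n⇒m⊓n≡m (≤-trans k≤count (≤-reflexive (sym (length-filter-oneTo n)))))

sum-mono-≤ : ∀ {n} {f g : Fin n → ℕ} → (∀ j → f j ≤ g j) → sum f ≤ sum g
sum-mono-≤ {zero}  f≤g = z≤n
sum-mono-≤ {suc n} f≤g = +-mono-≤ (f≤g zero) (sum-mono-≤ (f≤g ∘ suc))

term≤sum : ∀ {n} (f : Fin n → ℕ) j → f j ≤ sum f
term≤sum f zero    = m≤m+n _ _
term≤sum f (suc j) = ≤-trans (term≤sum (f ∘ suc) j) (m≤n+m _ _)

sum-const : ∀ n a → sum {n} (λ _ → a) ≡ n * a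
sum-const zero    a = refl
sum-const (suc n) a = cong (a +_) (sum-const n a)

sum-∸ : ∀ {n} (f g : Fin n → ℕ) → (∀ j → g j ≤ f j) → sum (λ j → f j ∸ g j) + sum g ≡ sum f
sum-∸ f g g≤f = trans (sym (∑-distrib-+ (λ j → f j ∸ g j) g)) (sum-cong-≗ (λ j → m∸n+n≡m (g≤f j)))

sum-χ-≟ : ∀ {n} (i : Fin n) → sum (λ j → χ (i ≟ᶠ j)) ≡ 1
sum-χ-≟ {suc n} zero    = cong suc (trans (sum-cong-≗ {n} (λ j → χ-no (zero ≟ᶠ suc j) (λ ()))) (trans (sum-const n 0) (*-zeroʳ n)))
sum-χ-≟ {suc n} (suc i) = trans (sum-cong-≗ {n} (λ j → χ-cong (suc i ≟ᶠ suc j) (i ≟ᶠ j) Fin.suc-injective (cong suc))) (sum-χ-≟ i)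

sum-χ-< : ∀ n r → r ≤ n → sum {n} (λ j → χ (toℕ j <? r)) ≡ r
sum-χ-< zero    zero    _         = refl
sum-χ-< (suc n) zero    _         = trans (sum-cong-≗ {n} (λ j → χ-no (suc (toℕ j) <? 0) (λ ()))) (trans (sum-const n 0) (*-zeroʳ n))
sum-χ-< (suc n) (suc r) (s≤s r≤n) =
  cong suc (trans (sum-cong-≗ {n} (λ j → χ-cong (suc (toℕ j) <? suc r) (toℕ j <? r) ≤-pred s≤s)) (sum-χ-< n r r≤n))

count-partition : ∀ {c} {P : Pred ℕ 0ℓ} (P? : Decidable P) (f : ℕ → Fin c) →
                  ∀ n → sum (λ j → count (P? ∩? (λ i → f i ≟ᶠ j)) n) ≡ count P? n
count-partition {c} P? f zero    = trans (sum-const c 0) (*-zeroʳ c)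
count-partition {c} P? f (suc n) = begin
  sum (λ j → χ ((P? ∩? (λ i → f i ≟ᶠ j)) (suc n)) + count (P? ∩? (λ i → f i ≟ᶠ j)) n)
    ≡⟨ ∑-distrib-+ (λ j → χ ((P? ∩? (λ i → f i ≟ᶠ j)) (suc n))) _ ⟩
  sum (λ j → χ ((P? ∩? (λ i → f i ≟ᶠ j)) (suc n))) + sum (λ j → count (P? ∩? (λ i → f i ≟ᶠ j)) n)
    ≡⟨ cong₂ _+_ (point (P? (suc n))) (count-partition P? f n) ⟩
  χ (P? (suc n)) + count P? n
    ∎
  where
  open ≡-Reasoning
  point : (a? : Dec _) → sum (λ j → χ (a? ×-dec (f (suc n) ≟ᶠ j))) ≡ χ a?
  point (yes a) = trans (sum-cong-≗ {c} (λ j → χ-cong (yes a ×-dec (f (suc n) ≟ᶠ j)) (f (suc n) ≟ᶠ j) proj₂ (a ,_)))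
                        (sum-χ-≟ (f (suc n)))
  point (no ¬a) = trans (sum-cong-≗ {c} (λ j → χ-no (no ¬a ×-dec (f (suc n) ≟ᶠ j)) (¬a ∘ proj₁)))
                        (trans (sum-const c 0) (*-zeroʳ c))

count-union-bound : ∀ {c} {P : Pred ℕ 0ℓ} {Q : Fin c → Pred ℕ 0ℓ} (P? : Decidable P) (Q? : ∀ j → Decidable (Q j)) →
                    (∀ i → P i → ∃ λ j → Q j i) → ∀ n → count P? n ≤ sum (λ j → count (Q? j) n)
count-union-bound P? Q? cover zero    = z≤n
count-union-bound P? Q? cover (suc n) = begin
  χ (P? (suc n)) + count P? n
    ≤⟨ +-mono-≤ (point (P? (suc n))) (count-union-bound P? Q? cover n) ⟩
  sum (λ j → χ (Q? j (suc n))) + sum (λ j → count (Q? j) n)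
    ≡⟨ ∑-distrib-+ (λ j → χ (Q? j (suc n))) _ ⟨
  sum (λ j → count (Q? j) (suc n))
    ∎
  where
  open ≤-Reasoning
  point : (a? : Dec _) → χ a? ≤ sum (λ j → χ (Q? j (suc n)))
  point (no _)  = z≤n
  point (yes a) with cover (suc n) a
  ... | j , Qj = ≤-trans (≤-reflexive (sym (χ-yes (Q? j (suc n)) Qj))) (term≤sum (λ j → χ (Q? j (suc n))) j)

pigeonhole : ∀ {c} (f : Fin c → ℕ) m → c * m < sum f → ∃ λ j → m < f j
pigeonhole {suc c} f m cm<Σf with m <? f zero
... | yes m<f0 = zero , m<f0
... | no m≮f0 with pigeonhole (f ∘ suc) m (+-cancelˡ-< m _ _ (≤-trans cm<Σf (+-monoˡ-≤ _ (≮⇒≥ m≮f0))))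
... | j , m<fj = suc j , m<fj

-- Primes

prime≥2 : ∀ {q} → Prime q → 2 ≤ q
prime≥2 {q} q-prime = nonTrivial⇒n>1 q {{prime⇒nonTrivial q-prime}}

prime-factor : ∀ n → 2 ≤ n → Σ ℕ λ q → Prime q × q ∣ n
prime-factor n@(suc _) 2≤n with factorise n
... | record { factors = [] ; isFactorisation = n≡1 } = ⊥-elim (<-irrefl (sym n≡1) 2≤n)
... | record { factors = q ∷ qs ; isFactorisation = n≡q*qs ; factorsPrime = q-prime ∷ _ } =
  q , q-prime , subst (q ∣_) (sym n≡q*qs) (m∣m*n _)

∣n! : ∀ {q n} → 1 ≤ q → q ≤ n → q ∣ n !
∣n! {suc q} _ q≤n = ∣-trans (m∣m*n (q !)) (m≤n⇒m!∣n! q≤n)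

-- Euclid: a prime factor of n! + 1 cannot be ≤ n.
prime-above : ∀ n → Σ ℕ λ r → Prime r × n < r × r ≤ n ! + 1
prime-above n with prime-factor (n ! + 1) (+-monoˡ-≤ 1 (1≤n! n))
... | r , r-prime , r∣n!+1 with n <? r
... | yes n<r = r , r-prime , n<r , ∣⇒≤ {{>-nonZero (m≤n+m 1 (n !))}} r∣n!+1
... | no  n≮r = ⊥-elim (<-irrefl refl (≤-trans (prime≥2 r-prime) (∣⇒≤ r∣1)))
  where r∣1 = ∣m+n∣m⇒∣n r∣n!+1 (∣n! (≤-trans (s≤s z≤n) (prime≥2 r-prime)) (≮⇒≥ n≮r))

firstPrimeFrom-spec : ∀ f s {r} → Prime r → s ≤ r → r ≤ s + f →
  Prime (firstPrimeFrom f s) × s ≤ firstPrimeFrom f s × (∀ i → s ≤ i → i < firstPrimeFrom f s → ¬ Prime i)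
firstPrimeFrom-spec zero s r-prime s≤r r≤s+0 with ≤-antisym s≤r (≤-trans r≤s+0 (≤-reflexive (+-identityʳ s)))
... | refl = r-prime , ≤-refl , λ i s≤i i<s → ⊥-elim (<-irrefl refl (≤-trans (s≤s s≤i) i<s))
firstPrimeFrom-spec (suc f) s r-prime s≤r r≤s+1+f with prime? s
... | yes s-prime = s-prime , ≤-refl , λ i s≤i i<s → ⊥-elim (<-irrefl refl (≤-trans (s≤s s≤i) i<s))
... | no ¬s-prime with firstPrimeFrom-spec f (suc s) r-prime (≤∧≢⇒< s≤r s≢r) (≤-trans r≤s+1+f (≤-reflexive (+-suc s f)))
  where s≢r = λ s≡r → ¬s-prime (subst Prime (sym s≡r) r-prime)
... | q-prime , s<q , gap = q-prime , ≤-trans (n≤1+n s) s<q , gap′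
  where
  gap′ : ∀ i → s ≤ i → i < firstPrimeFrom f (suc s) → ¬ Prime i
  gap′ i s≤i i<q with s ≟ i
  ... | yes refl = ¬s-prime
  ... | no s≢i   = gap i (≤∧≢⇒< s≤i s≢i) i<q

nextPrime-spec : ∀ n → Prime (nextPrime n) × n < nextPrime n × (∀ i → n < i → i < nextPrime n → ¬ Prime i)
nextPrime-spec n with prime-above n
... | r , r-prime , n<r , r≤n!+1 =
  firstPrimeFrom-spec (n !) (suc n) r-prime n<r (≤-trans r≤n!+1 (≤-trans (≤-reflexive (+-comm (n !) 1)) (+-monoˡ-≤ (n !) (s≤s z≤n))))

p-prime : ∀ m → Prime (p (suc m))
p-prime m = proj₁ (nextPrime-spec (p m))

p-< : ∀ m → p m < p (suc m)
p-< m = proj₁ (proj₂ (nextPrime-spec (p m)))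

p-gap : ∀ m i → p m < i → i < p (suc m) → ¬ Prime i
p-gap m = proj₂ (proj₂ (nextPrime-spec (p m)))

m<p : ∀ m → m < p m
m<p zero    = ≤-refl
m<p (suc m) = ≤-trans (s≤s (m<p m)) (p-< m)

π : ℕ → ℕ
π = count prime?

π-p : ∀ m → π (p m) ≡ m
π-p zero    = refl
π-p (suc m) = trans (count-step prime? (p-< m) (p-gap m) (p-prime m)) (cong suc (π-p m))

π-p∸1 : ∀ m → π (p (suc m) ∸ 1) ≡ m
π-p∸1 m = trans (count-gap prime? pm≤ (λ i pm<i i≤ → p-gap m i pm<i (≤-trans (s≤s i≤) (≤-reflexive p[1+m]≡)))) (π-p m)
  where
  p[1+m]≡ : suc (p (suc m) ∸ 1) ≡ p (suc m)
  p[1+m]≡ = suc-pred (p (suc m)) {{>-nonZero (≤-trans (s≤s z≤n) (m<p (suc m)))}}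
  pm≤ : p m ≤ p (suc m) ∸ 1
  pm≤ = ≤-pred (≤-trans (p-< m) (≤-reflexive (sym p[1+m]≡)))

-- Slots: 1 and the primes

Slot : ℕ → Set
Slot i = Prime i ⊎ i ≡ 1

slot? : Decidable Slot
slot? = prime? ∪? (_≟ 1)

ι : ℕ → ℕ
ι = count slot?

ι≡1+π : ∀ {n} → 1 ≤ n → ι n ≡ suc (π n)
ι≡1+π {n} 1≤n = begin
  count (prime? ∪? (_≟ 1)) n     ≡⟨ count-∪ prime? (_≟ 1) (λ { i i-prime refl → <-irrefl refl (prime≥2 i-prime) }) n ⟩
  π n + count (_≟ 1) n           ≡⟨ cong (π n +_) (count-singleton ≤-refl 1≤n) ⟩
  π n + 1                        ≡⟨ +-comm (π n) 1 ⟩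
  suc (π n)                      ∎
  where open ≡-Reasoning

ι-p∸1 : ∀ m → 1 ≤ m → ι (p m ∸ 1) ≡ m
ι-p∸1 (suc m) _ = trans (ι≡1+π (≤-trans (s≤s z≤n) (∸-monoˡ-≤ 1 (m<p (suc m))))) (cong suc (π-p∸1 m))

coprime-slots : ∀ {a b} → Slot a → Slot b → a ≢ b → Coprime a b
coprime-slots (inj₂ refl) _ _ (d∣1 , _) = ∣1⇒≡1 d∣1
coprime-slots (inj₁ _) (inj₂ refl) _ (_ , d∣1) = ∣1⇒≡1 d∣1
coprime-slots (inj₁ a-prime) (inj₁ b-prime) a≢b (d∣a , d∣b) with prime⇒irreducible a-prime d∣a
... | inj₁ d≡1 = d≡1
... | inj₂ refl with prime⇒irreducible b-prime d∣b
...   | inj₁ a≡1 = ⊥-elim (<-irrefl (sym a≡1) (prime≥2 a-prime))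
...   | inj₂ a≡b = ⊥-elim (a≢b a≡b)

pairwise-coprime-slots : ∀ {ys} → All Slot ys → Unique ys → AllPairs (λ a b → a ≢ b × Coprime a b) ys
pairwise-coprime-slots []                []              = []
pairwise-coprime-slots (a-slot ∷ slots) (a∉ys ∷ unique) =
  All.zipWith (λ (b-slot , a≢b) → a≢b , λ {d} → coprime-slots a-slot b-slot a≢b {d}) (slots , a∉ys)
  ∷ pairwise-coprime-slots slots unique

many-slots⇒coprime-class : ∀ {c} (col : ℕ → Fin c) n j k →
  k ≤ count (slot? ∩? (λ i → col i ≟ᶠ j)) n → ClassHasCoprimeK col n j k
many-slots⇒coprime-class col n j k k≤count with distinct-list-of-count (slot? ∩? (λ i → col i ≟ᶠ j)) k≤count
... | ys , length≡k , ys-in-class , unique =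
  ys , length≡k , All.map (λ (1≤a , a≤n , _ , col≡j) → 1≤a , a≤n , col≡j) ys-in-class ,
  pairwise-coprime-slots (All.map (λ (_ , _ , a-slot , _) → a-slot) ys-in-class) unique

coprime-free⇒≤ : ∀ {c} k n (col : ℕ → Fin c) → 1 ≤ k → (∀ j → ¬ ClassHasCoprimeK col n j k) →
                 n ≤ p (c * (k ∸ 1)) ∸ 1
coprime-free⇒≤ {c} k n col 1≤k coprime-free with n ≤? p (c * (k ∸ 1)) ∸ 1
... | yes n≤x = n≤x
... | no  n≰x = ⊥-elim (coprime-free j (many-slots⇒coprime-class col n j k k≤count))
  where
  M = c * (k ∸ 1)
  classSlots : Fin c → ℕ
  classSlots j = count (slot? ∩? (λ i → col i ≟ᶠ j)) n
  pM≤n : p M ≤ n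
  pM≤n = ≤-trans (≤-reflexive (sym (suc-pred (p M) {{>-nonZero (≤-trans (s≤s z≤n) (m<p M))}}))) (≰⇒> n≰x)
  M<Σ : M < sum classSlots
  M<Σ = begin-strict
    M                  ≡⟨ π-p M ⟨
    π (p M)            <⟨ ≤-reflexive (sym (ι≡1+π (≤-trans (s≤s z≤n) (m<p M)))) ⟩
    ι (p M)            ≤⟨ count-monoʳ-≤ slot? pM≤n ⟩
    ι n                ≡⟨ count-partition slot? col n ⟨
    sum classSlots     ∎
    where open ≤-Reasoning
  crowded = pigeonhole classSlots (k ∸ 1) M<Σ
  j = proj₁ crowded
  k≤count : k ≤ classSlots j
  k≤count = ≤-trans (≤-reflexive (sym (m+[n∸m]≡n 1≤k))) (proj₂ crowded)

-- Distinct coprime numbers can share only the witness 1, and only 1 has witness 1.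
Witnessed : (ℕ → ℕ) → Pred ℕ 0ℓ → Pred ℕ 0ℓ
Witnessed wit T a = wit a ∣ a × (wit a ≡ 1 → a ≡ 1) × T (wit a)

module _ (wit : ℕ → ℕ) {T : Pred ℕ 0ℓ} where

  witnesses-distinct : ∀ {a b} → Witnessed wit T a → Witnessed wit T b → a ≢ b → Coprime a b → wit a ≢ wit b
  witnesses-distinct {a} {b} (wa∣a , wa≡1⇒a≡1 , _) (wb∣b , wb≡1⇒b≡1 , _) a≢b coprime wa≡wb =
    a≢b (trans (wa≡1⇒a≡1 wa≡1) (sym (wb≡1⇒b≡1 (trans (sym wa≡wb) wa≡1))))
    where wa≡1 = coprime (wa∣a , subst (_∣ b) (sym wa≡wb) wb∣b)

  witnesses-unique : ∀ {xs} → All (Witnessed wit T) xs → AllPairs (λ a b → a ≢ b × Coprime a b) xs → Unique (map wit xs)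
  witnesses-unique []         []          = []
  witnesses-unique (wa ∷ ws) (ra ∷ rs) =
    All-map⁺ (All.zipWith (λ (wb , a≢b , coprime) → witnesses-distinct wa wb a≢b coprime) (ws , ra)) ∷ witnesses-unique ws rs

  coprime-length≤count : (T? : Decidable T) → ∀ n {xs} → All (λ a → 1 ≤ a × a ≤ n × Witnessed wit T a) xs →
                         AllPairs (λ a b → a ≢ b × Coprime a b) xs → length xs ≤ count T? n
  coprime-length≤count T? n {xs} witnessed pairwise = begin
    length xs            ≡⟨ length-map wit xs ⟨
    length (map wit xs)  ≤⟨ distinct-length≤count T? n (map wit xs) (witnesses-unique (All.map (proj₂ ∘ proj₂) witnessed) pairwise)
                                                                     (All-map⁺ (All.map witness-in-range witnessed)) ⟩
    count T? n           ∎
    where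
    open ≤-Reasoning
    witness-in-range : ∀ {a} → 1 ≤ a × a ≤ n × Witnessed wit T a → InRange n T (wit a)
    witness-in-range {a} (1≤a , a≤n , wa∣a , _ , Twa) = 1≤wa , ≤-trans (∣⇒≤ {{>-nonZero 1≤a}} wa∣a) a≤n , Twa
      where
      1≤wa : 1 ≤ wit a
      1≤wa with wit a
      ... | zero  = ⊥-elim (<-irrefl (sym (0∣⇒≡0 wa∣a)) 1≤a)
      ... | suc _ = s≤s z≤n

slotDivisor : ℕ → ℕ
slotDivisor zero            = 0
slotDivisor (suc zero)      = 1
slotDivisor n@(suc (suc _)) = proj₁ (prime-factor n (s≤s (s≤s z≤n)))

slotDivisor-witnesses : ∀ {n} → 1 ≤ n → Witnessed slotDivisor Slot n
slotDivisor-witnesses {suc zero}    _ = ∣-refl , (λ _ → refl) , inj₂ refl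
slotDivisor-witnesses {n@(suc (suc _))} _ with prime-factor n (s≤s (s≤s z≤n))
... | q , q-prime , q∣n = q∣n , (λ q≡1 → ⊥-elim (<-irrefl (sym q≡1) (prime≥2 q-prime))) , inj₁ q-prime

-- Numbers free of a list of primes

FreeOf : List ℕ → Pred ℕ 0ℓ
FreeOf G n = All (λ q → ¬ q ∣ n) G

freeOf? : ∀ G → Decidable (FreeOf G)
freeOf? G n = all? (λ q → ¬? (q ∣? n)) G

module _ (G : List ℕ) where

  private
    divides-product : All (_∣ product G) G
    divides-product = All.tabulate ∈⇒∣product

  free-+product⁻ : ∀ {n} → FreeOf G (product G + n) → FreeOf G n
  free-+product⁻ free = All.zipWith (λ (q∣Q , q∤Q+n) q∣n → q∤Q+n (∣m∣n⇒∣m+n q∣Q q∣n)) (divides-product , free)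

  free-+product⁺ : ∀ {n} → FreeOf G n → FreeOf G (product G + n)
  free-+product⁺ free = All.zipWith (λ (q∣Q , q∤n) q∣Q+n → q∤n (∣m+n∣m⇒∣n q∣Q+n q∣Q)) (divides-product , free)

module _ {P : Pred ℕ 0ℓ} (P? : Decidable P) (Q : ℕ)
         (period⁻ : ∀ {i} → P (Q + i) → P i) (period⁺ : ∀ {i} → P i → P (Q + i)) where

  count-periodic : ∀ a r → count P? (a * Q + r) ≡ a * count P? Q + count P? r
  count-periodic zero    r = refl
  count-periodic (suc a) r = begin
    count P? (Q + a * Q + r)                                  ≡⟨ cong (count P?) (+-assoc Q (a * Q) r) ⟩
    count P? (Q + (a * Q + r))                                ≡⟨ count-+ P? Q (a * Q + r) ⟩
    count P? Q + count (shift? P? Q) (a * Q + r)              ≡⟨ cong (count P? Q +_) shift-invariant ⟩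
    count P? Q + count P? (a * Q + r)                         ≡⟨ cong (count P? Q +_) (count-periodic a r) ⟩
    count P? Q + (a * count P? Q + count P? r)                ≡⟨ +-assoc (count P? Q) _ _ ⟨
    count P? Q + a * count P? Q + count P? r                  ∎
    where
    open ≡-Reasoning
    shift-invariant = count-cong (shift? P? Q) P? (a * Q + r) (λ _ _ _ → period⁻) (λ _ _ _ → period⁺)

  count-periodic-≤ : .{{_ : NonZero Q}} → ∀ x → count P? x ≤ x / Q * count P? Q + Q
  count-periodic-≤ x = begin
    count P? x                                 ≡⟨ cong (count P?) (trans (m≡m%n+[m/n]*n x Q) (+-comm (x % Q) _)) ⟩
    count P? (x / Q * Q + x % Q)               ≡⟨ count-periodic (x / Q) (x % Q) ⟩
    x / Q * count P? Q + count P? (x % Q)      ≤⟨ +-monoʳ-≤ (x / Q * count P? Q) (≤-trans (count≤ P? (x % Q)) (<⇒≤ (m%n<n x Q))) ⟩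
    x / Q * count P? Q + Q                     ∎
    where open ≤-Reasoning

  count-periodic-* : ∀ a → count P? (a * Q) ≡ a * count P? Q
  count-periodic-* a = begin
    count P? (a * Q)                 ≡⟨ cong (count P?) (+-identityʳ (a * Q)) ⟨
    count P? (a * Q + 0)             ≡⟨ count-periodic a 0 ⟩
    a * count P? Q + 0               ≡⟨ +-identityʳ _ ⟩
    a * count P? Q                   ∎
    where open ≡-Reasoning

Scaled : (s : ℕ) → .{{NonZero s}} → Pred ℕ 0ℓ → Pred ℕ 0ℓ
Scaled s P n = s ∣ n × P (n / s)

scaled? : ∀ s .{{_ : NonZero s}} {P : Pred ℕ 0ℓ} → Decidable P → Decidable (Scaled s P)
scaled? s P? n = (s ∣? n) ×-dec P? (n / s)

count-scaled : ∀ s .{{_ : NonZero s}} {P : Pred ℕ 0ℓ} (P? : Decidable P) y →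
               count (scaled? s P?) (s * y) ≡ count P? y
count-scaled s P? zero = cong (count (scaled? s P?)) (*-zeroʳ s)
count-scaled s@(suc s₁) {P} P? (suc y) = begin
  count S? (s * suc y)                                          ≡⟨ cong (count S?) (trans (*-suc s y) (+-comm s (s * y))) ⟩
  count S? (s * y + s)                                          ≡⟨ count-+ S? (s * y) s ⟩
  count S? (s * y) + (χ (S? (s * y + s)) + count (shift? S? (s * y)) s₁)
                                                                ≡⟨ cong₂ _+_ (count-scaled s P? y) (cong (χ (S? (s * y + s)) +_) no-multiples) ⟩
  count P? y + (χ (S? (s * y + s)) + 0)                         ≡⟨ cong (count P? y +_) (trans (+-identityʳ _) last-multiple) ⟩
  count P? y + χ (P? (suc y))                                   ≡⟨ +-comm (count P? y) _ ⟩
  count P? (suc y)                                              ∎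
  where
  open ≡-Reasoning
  S? = scaled? s P?
  sy+s≡[1+y]s : s * y + s ≡ suc y * s
  sy+s≡[1+y]s = trans (+-comm (s * y) s) (cong (s +_) (*-comm s y))
  [sy+s]/s≡1+y : (s * y + s) / s ≡ suc y
  [sy+s]/s≡1+y = trans (cong (_/ s) sy+s≡[1+y]s) (m*n/n≡m (suc y) s)
  no-multiples : count (shift? S? (s * y)) s₁ ≡ 0
  no-multiples = count-none (shift? S? (s * y)) s₁ λ i 1≤i i≤s₁ (s∣sy+i , _) →
    <-irrefl refl (≤-trans (s≤s (∣⇒≤ {{>-nonZero 1≤i}} (∣m+n∣m⇒∣n s∣sy+i (m∣m*n y)))) (s≤s i≤s₁))
  last-multiple : χ (S? (s * y + s)) ≡ χ (P? (suc y))
  last-multiple = χ-cong (S? (s * y + s)) (P? (suc y)) (subst P [sy+s]/s≡1+y ∘ proj₂)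
                         (λ P[1+y] → divides (suc y) sy+s≡[1+y]s , subst P (sym [sy+s]/s≡1+y) P[1+y])

firstDivisor : List ℕ → ℕ → ℕ
firstDivisor []      n = 0
firstDivisor (q ∷ G) n with q ∣? n
... | yes _ = q
... | no  _ = firstDivisor G n

firstDivisor-spec : ∀ {P : Pred ℕ 0ℓ} G n → All P G → ¬ FreeOf G n → P (firstDivisor G n) × firstDivisor G n ∣ n
firstDivisor-spec []      n []         ¬free = ⊥-elim (¬free [])
firstDivisor-spec (q ∷ G) n (Pq ∷ PG) ¬free with q ∣? n
... | yes q∣n = Pq , q∣n
... | no  q∤n = firstDivisor-spec G n PG (¬free ∘ (q∤n ∷_))

-- Sieving blocks of primes

∑< : ℕ → (ℕ → ℕ) → ℕ
∑< zero    f = 0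
∑< (suc T) f = ∑< T f + f T

∑<-mono-≤ : ∀ T {f g : ℕ → ℕ} → (∀ t → t < T → f t ≤ g t) → ∑< T f ≤ ∑< T g
∑<-mono-≤ zero    f≤g = z≤n
∑<-mono-≤ (suc T) f≤g = +-mono-≤ (∑<-mono-≤ T (λ t t<T → f≤g t (m≤n⇒m≤1+n t<T))) (f≤g T ≤-refl)

∑<-+ : ∀ a b (f : ℕ → ℕ) → ∑< (a + b) f ≡ ∑< a f + ∑< b (λ t → f (a + t))
∑<-+ a zero    f = trans (cong (λ T → ∑< T f) (+-identityʳ a)) (sym (+-identityʳ _))
∑<-+ a (suc b) f = trans (cong (λ T → ∑< T f) (+-suc a b)) (trans (cong (_+ f (a + b)) (∑<-+ a b f)) (+-assoc (∑< a f) _ _))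

∑<-*-distribʳ : ∀ T (f : ℕ → ℕ) c → ∑< T (λ t → f t * c) ≡ ∑< T f * c
∑<-*-distribʳ zero    f c = refl
∑<-*-distribʳ (suc T) f c = trans (cong (_+ f T * c) (∑<-*-distribʳ T f c)) (sym (*-distribʳ-+ c (∑< T f) (f T)))

∑<-const-≤ : ∀ T (f : ℕ → ℕ) c → (∀ t → t < T → c ≤ f t) → T * c ≤ ∑< T f
∑<-const-≤ zero    f c c≤f = z≤n
∑<-const-≤ (suc T) f c c≤f =
  ≤-trans (≤-reflexive (+-comm c (T * c))) (+-mono-≤ (∑<-const-≤ T f c (λ t t<T → c≤f t (m≤n⇒m≤1+n t<T))) (c≤f T ≤-refl))

module _ {D : ℕ → Pred ℕ 0ℓ} (D? : ∀ t → Decidable (D t)) where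

  private
    SomeBelow : ℕ → Pred ℕ 0ℓ
    SomeBelow zero    i = ⊥
    SomeBelow (suc T) i = SomeBelow T i ⊎ D T i

    someBelow? : ∀ T → Decidable (SomeBelow T)
    someBelow? zero    i = no λ ()
    someBelow? (suc T)   = someBelow? T ∪? D? T

    witness : ∀ T {i} → SomeBelow T i → ∃ λ t → t < T × D t i
    witness (suc T) (inj₁ below) with witness T below
    ... | t , t<T , Dti = t , m≤n⇒m≤1+n t<T , Dti
    witness (suc T) (inj₂ DTi) = T , ≤-refl , DTi

    count-someBelow : ∀ T n → (∀ {t u i} → t < u → u < T → D t i → D u i → ⊥) →
                      count (someBelow? T) n ≡ ∑< T (λ t → count (D? t) n)
    count-someBelow zero    n disjoint = count-none (someBelow? 0) n (λ _ _ _ ())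
    count-someBelow (suc T) n disjoint = trans
      (count-∪ (someBelow? T) (D? T) (λ i below DTi → let (t , t<T , Dti) = witness T below in disjoint t<T ≤-refl Dti DTi) n)
      (cong (_+ count (D? T) n) (count-someBelow T n (λ t<u u<T → disjoint t<u (m≤n⇒m≤1+n u<T))))

  ∑<-count-disjoint≤ : ∀ T n → (∀ {t u i} → t < u → u < T → D t i → D u i → ⊥) →
                       ∑< T (λ t → count (D? t) n) ≤ n
  ∑<-count-disjoint≤ T n disjoint = ≤-trans (≤-reflexive (sym (count-someBelow T n disjoint))) (count≤ (someBelow? T) n)

2*[a/u]≤[2*a]/u : ∀ a u .{{_ : NonZero u}} → 2 * (a / u) ≤ (2 * a) / u
2*[a/u]≤[2*a]/u a u = ≤-trans (≤-reflexive (sym (m*n/n≡m (2 * (a / u)) u)))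
                              (/-monoˡ-≤ u (≤-trans (≤-reflexive (*-assoc 2 (a / u) u)) (*-monoʳ-≤ 2 (m/n*n≤m a u))))

harmonicMass : ℕ → ℕ
harmonicMass W = ∑< W (λ t → W / suc t)

-- Doubling W adds at least W: the new terms 2W/(t+1) for t ≥ W are ≥ 1, the old ones at least double.
harmonicMass-double : ∀ w → w + 2 * harmonicMass w ≤ harmonicMass (w + w)
harmonicMass-double w = begin
  w + 2 * harmonicMass w                  ≡⟨ cong₂ _+_ (sym (*-identityʳ w)) (trans (*-comm 2 (harmonicMass w)) (sym (∑<-*-distribʳ w _ 2))) ⟩
  w * 1 + ∑< w (λ t → w / suc t * 2)       ≤⟨ +-mono-≤ (∑<-const-≤ w (g ∘ (w +_)) 1 new-term≥1) (∑<-mono-≤ w old-term-doubles) ⟩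
  ∑< w (g ∘ (w +_)) + ∑< w g               ≡⟨ trans (+-comm _ (∑< w g)) (sym (∑<-+ w w g)) ⟩
  harmonicMass (w + w)                    ∎
  where
  open ≤-Reasoning
  g : ℕ → ℕ
  g t = (w + w) / suc t
  new-term≥1 : ∀ t → t < w → 1 ≤ g (w + t)
  new-term≥1 t t<w = m≥n⇒m/n>0 (≤-trans (≤-reflexive (sym (+-suc w t))) (+-monoʳ-≤ w t<w))
  old-term-doubles : ∀ t → t < w → w / suc t * 2 ≤ g t
  old-term-doubles t _ = ≤-trans (≤-reflexive (*-comm (w / suc t) 2))
                                 (≤-trans (2*[a/u]≤[2*a]/u w (suc t)) (≤-reflexive (cong (λ v → (w + v) / suc t) (+-identityʳ w))))

m*2^m≤2*harmonicMass : ∀ m → m * 2 ^ m ≤ 2 * harmonicMass (2 ^ m)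
m*2^m≤2*harmonicMass zero    = z≤n
m*2^m≤2*harmonicMass (suc m) = begin
  suc m * 2 ^ suc m                      ≡⟨ solve 2 (λ m w → (con 1 :+ m) :* (con 2 :* w) := con 2 :* (w :+ m :* w)) refl m w ⟩
  2 * (w + m * w)                        ≤⟨ *-monoʳ-≤ 2 (+-monoʳ-≤ w (m*2^m≤2*harmonicMass m)) ⟩
  2 * (w + 2 * harmonicMass w)           ≤⟨ *-monoʳ-≤ 2 (harmonicMass-double w) ⟩
  2 * harmonicMass (w + w)               ≡⟨ cong (λ v → 2 * harmonicMass (w + v)) (sym (+-identityʳ w)) ⟩
  2 * harmonicMass (2 ^ suc m)           ∎
  where
  open ≤-Reasoning
  w = 2 ^ m

coprime-by-prime-factors : ∀ {a b} → 1 ≤ a → (∀ {q} → Prime q → q ∣ a → ¬ q ∣ b) → Coprime a b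
coprime-by-prime-factors 1≤a no-common-prime {zero} (0∣a , _) = ⊥-elim (<-irrefl (sym (0∣⇒≡0 0∣a)) 1≤a)
coprime-by-prime-factors 1≤a no-common-prime {1}    _         = refl
coprime-by-prime-factors 1≤a no-common-prime {d@(suc (suc _))} (d∣a , d∣b) with prime-factor d (s≤s (s≤s z≤n))
... | q , q-prime , q∣d = ⊥-elim (no-common-prime q-prime (∣-trans q∣d d∣a) (∣-trans q∣d d∣b))

primesIn : ℕ → ℕ → List ℕ
primesIn A B = filter (prime? ∩? (A <?_)) (oneTo B)

primesIn-sound : ∀ A B → All (λ q → Prime q × A < q × q ≤ B) (primesIn A B)
primesIn-sound A B = All.zipWith (λ ((q-prime , A<q) , (_ , q≤B)) → q-prime , A<q , q≤B)
                                 (all-filter (prime? ∩? (A <?_)) (oneTo B) , All-filter⁺ (prime? ∩? (A <?_)) (oneTo-range B))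

primesIn-prime : ∀ A B → All Prime (primesIn A B)
primesIn-prime A B = All.map proj₁ (primesIn-sound A B)

∈-primesIn : ∀ {A B q} → Prime q → A < q → q ≤ B → q ∈ primesIn A B
∈-primesIn q-prime A<q q≤B = ∈-filter⁺ (prime? ∩? (_ <?_)) (∈-oneTo (≤-trans (s≤s z≤n) (prime≥2 q-prime)) q≤B) (q-prime , A<q)

-- Every prime factor of s t = 1 + t·A! (t < W) lies in (A, B], so the sets of numbers s t · m
-- with m free of those primes are pairwise disjoint. They have densities φ/(Q · s t), and
-- ∑_{t<W} 1/s t ≥ m/(2·A!) for W = 2^m; with m = 2·A!·N this forces φ/Q ≤ 1/N.
module SievingBlock (N A : ℕ) where

  P = A !
  m = 2 * (P * N)
  W = 2 ^ m
  B = W * P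
  G = primesIn A B
  Q = product G
  φ = count (freeOf? G) Q
  X = Q * (P * W)

  s : ℕ → ℕ
  s t = suc (t * P)

  instance
    P-nonZero : NonZero P
    P-nonZero = >-nonZero (1≤n! A)

  s≤B : ∀ {t} → t < W → s t ≤ B
  s≤B t<W = ≤-trans (+-monoˡ-≤ _ (1≤n! A)) (*-monoˡ-≤ P t<W)

  s≤P*[1+t] : ∀ t → s t ≤ P * suc t
  s≤P*[1+t] t = ≤-trans (+-monoˡ-≤ (t * P) (1≤n! A)) (≤-reflexive (trans (cong (P +_) (*-comm t P)) (sym (*-suc P t))))

  s-coprime-free : ∀ {t a} → t < W → FreeOf G a → Coprime (s t) a
  s-coprime-free {t} t<W free = coprime-by-prime-factors (s≤s z≤n) λ q-prime q∣s →
    All.lookup free (∈-primesIn q-prime (A<q q-prime q∣s) (≤-trans (∣⇒≤ q∣s) (s≤B t<W)))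
    where
    A<q : ∀ {q} → Prime q → q ∣ s t → A < q
    A<q {q} q-prime q∣s with A <? q
    ... | yes A<q = A<q
    ... | no  A≮q = ⊥-elim (<-irrefl (sym (∣1⇒≡1 q∣1)) (prime≥2 q-prime))
      where q∣1 = ∣m+n∣m⇒∣n (subst (q ∣_) (+-comm 1 (t * P)) q∣s)
                             (∣-trans (∣n! (≤-trans (s≤s z≤n) (prime≥2 q-prime)) (≮⇒≥ A≮q)) (n∣m*n t))

  multiples-disjoint : ∀ {t u n} → t < u → u < W → Scaled (s t) (FreeOf G) n → Scaled (s u) (FreeOf G) n → ⊥
  multiples-disjoint {t} {u} {n} t<u u<W t-mult u-mult =
    <-irrefl (*-cancelʳ-≡ t u P (suc-injective (∣-antisym (s∣s {t} {u} t<W t-mult u-mult) (s∣s {u} {t} u<W u-mult t-mult)))) t<u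
    where
    t<W = <-trans t<u u<W
    s∣s : ∀ {a b} → a < W → Scaled (s a) (FreeOf G) n → Scaled (s b) (FreeOf G) n → s a ∣ s b
    s∣s {a} {b} a<W (sa∣n , _) (sb∣n , n/sb-free) =
      coprime-divisor (s-coprime-free a<W n/sb-free) (subst (s a ∣_) (sym (trans (*-comm _ (s b)) (m*[n/m]≡n sb∣n))) sa∣n)

  multiples-many : ∀ t → (W / suc t) * φ ≤ count (scaled? (s t) (freeOf? G)) X
  multiples-many t = begin
    (W / suc t) * φ                            ≤⟨ *-monoˡ-≤ φ W/[1+t]≤PW/s ⟩
    (P * W / s t) * φ                          ≡⟨ count-periodic-* (freeOf? G) Q (free-+product⁻ G) (free-+product⁺ G) (P * W / s t) ⟨
    count (freeOf? G) ((P * W / s t) * Q)      ≤⟨ count-monoʳ-≤ (freeOf? G) PW/s*Q≤X/s ⟩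
    count (freeOf? G) (X / s t)                ≡⟨ count-scaled (s t) (freeOf? G) (X / s t) ⟨
    count S? (s t * (X / s t))                 ≤⟨ count-monoʳ-≤ S? (≤-trans (≤-reflexive (*-comm (s t) (X / s t))) (m/n*n≤m X (s t))) ⟩
    count S? X                                 ∎
    where
    open ≤-Reasoning
    S? = scaled? (s t) (freeOf? G)
    instance
      P*[1+t]-nonZero : NonZero (P * suc t)
      P*[1+t]-nonZero = >-nonZero (≤-trans (1≤n! A) (m≤m*n P (suc t)))
    W/[1+t]≤PW/s : W / suc t ≤ P * W / s t
    W/[1+t]≤PW/s = ≤-trans (≤-reflexive (sym (m*n/m*o≡n/o P W (suc t)))) (/-monoʳ-≤ (P * W) (s≤P*[1+t] t))
    PW/s*Q≤X/s : (P * W / s t) * Q ≤ X / s t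
    PW/s*Q≤X/s = ≤-trans (≤-reflexive (sym (m*n/n≡m (P * W / s t * Q) (s t))))
      (/-monoˡ-≤ (s t) (≤-trans (≤-reflexive (solve 3 (λ a b c → a :* b :* c := b :* (a :* c)) refl (P * W / s t) Q (s t)))
                                 (*-monoʳ-≤ Q (m/n*n≤m (P * W) (s t)))))

  harmonicMass*φ≤X : harmonicMass W * φ ≤ X
  harmonicMass*φ≤X = begin
    harmonicMass W * φ                                     ≡⟨ ∑<-*-distribʳ W (λ t → W / suc t) φ ⟨
    ∑< W (λ t → (W / suc t) * φ)                           ≤⟨ ∑<-mono-≤ W (λ t _ → multiples-many t) ⟩
    ∑< W (λ t → count (S? t) X)                            ≤⟨ ∑<-count-disjoint≤ S? W X multiples-disjoint ⟩
    X                                                      ∎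
    where
    open ≤-Reasoning
    S? = λ t → scaled? (s t) (freeOf? G)

  φ*N≤Q : φ * N ≤ Q
  φ*N≤Q = *-cancelˡ-≤ (2 * P * W) {{>-nonZero 1≤2PW}} (begin
    2 * P * W * (φ * N)           ≡⟨ solve 4 (λ p w f n → con 2 :* p :* w :* (f :* n) := con 2 :* (p :* n) :* w :* f) refl P W φ N ⟩
    m * W * φ                     ≤⟨ *-monoˡ-≤ φ (m*2^m≤2*harmonicMass m) ⟩
    2 * harmonicMass W * φ        ≡⟨ *-assoc 2 (harmonicMass W) φ ⟩
    2 * (harmonicMass W * φ)      ≤⟨ *-monoʳ-≤ 2 harmonicMass*φ≤X ⟩
    2 * X                         ≡⟨ solve 3 (λ q p w → con 2 :* (q :* (p :* w)) := con 2 :* p :* w :* q) refl Q P W ⟩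
    2 * P * W * Q                 ∎)
    where
    open ≤-Reasoning
    1≤2PW : 1 ≤ 2 * P * W
    1≤2PW = *-mono-≤ (*-mono-≤ (s≤s (z≤n {1})) (1≤n! A)) (m^n>0 2 m)

  A≤B : A ≤ B
  A≤B = ≤-trans (n≤n! A) (≤-trans (≤-reflexive (sym (*-identityˡ P))) (*-monoˡ-≤ P (m^n>0 2 m)))
    where
    n≤n! : ∀ n → n ≤ n !
    n≤n! zero    = z≤n
    n≤n! (suc n) = m≤m*n (suc n) (n !) {{>-nonZero (1≤n! n)}}

sieving-block : ∀ N A → Σ ℕ λ B → A ≤ B × count (freeOf? (primesIn A B)) (product (primesIn A B)) * N ≤ product (primesIn A B)
sieving-block N A = B , A≤B , φ*N≤Q
  where open SievingBlock N A

-- Colouring by consecutive blocks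

blockOf : ∀ {c} → (Fin (suc c) → ℕ) → ℕ → Fin (suc c)
blockOf {zero}  caps i = zero
blockOf {suc c} caps i with i ≤? caps zero
... | yes _ = zero
... | no  _ = suc (blockOf (caps ∘ suc) (i ∸ caps zero))

partialSum : ∀ {n} → (Fin n → ℕ) → Fin n → ℕ
partialSum caps zero    = 0
partialSum caps (suc j) = caps zero + partialSum (caps ∘ suc) j

module _ {c} (caps : Fin (suc (suc c)) → ℕ) where

  blockOf-head : ∀ {i} → i ≤ caps zero → blockOf caps i ≡ zero
  blockOf-head {i} i≤caps₀ with i ≤? caps zero
  ... | yes _    = refl
  ... | no  i≰caps₀ = ⊥-elim (i≰caps₀ i≤caps₀)

  blockOf-tail : ∀ {i} → 1 ≤ i → blockOf caps (caps zero + i) ≡ suc (blockOf (caps ∘ suc) i)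
  blockOf-tail {i@(suc _)} _ with caps zero + i ≤? caps zero
  ... | yes caps₀+i≤caps₀ = ⊥-elim (m+1+n≰m (caps zero) caps₀+i≤caps₀)
  ... | no  _             = cong (suc ∘ blockOf (caps ∘ suc)) (m+n∸m≡n (caps zero) i)

blockOf-count : ∀ {c} (caps : Fin (suc c) → ℕ) j → count (λ i → blockOf caps i ≟ᶠ j) (sum caps) ≡ caps j
blockOf-count {zero}  caps zero = trans (cong (count (λ i → blockOf caps i ≟ᶠ zero)) (+-identityʳ (caps zero)))
                                        (count-all (λ i → blockOf caps i ≟ᶠ zero) (caps zero) (λ _ _ _ → refl))
blockOf-count {suc c} caps j    = trans (count-+ (B? j) (caps zero) (sum (caps ∘ suc))) (split j)
  where
  B? : ∀ j → Decidable (λ i → blockOf caps i ≡ j)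
  B? j i = blockOf caps i ≟ᶠ j
  split : ∀ j → count (B? j) (caps zero) + count (shift? (B? j) (caps zero)) (sum (caps ∘ suc)) ≡ caps j
  split zero = trans
    (cong₂ _+_ (count-all (B? zero) (caps zero) (λ _ _ i≤caps₀ → blockOf-head caps i≤caps₀))
               (count-none (shift? (B? zero) (caps zero)) (sum (caps ∘ suc))
                           (λ _ 1≤i _ b≡0 → Fin.0≢1+n (trans (sym b≡0) (blockOf-tail caps 1≤i)))))
    (+-identityʳ _)
  split (suc j) = trans
    (cong₂ _+_ (count-none (B? (suc j)) (caps zero) (λ _ _ i≤caps₀ b≡1+j → Fin.0≢1+n (trans (sym (blockOf-head caps i≤caps₀)) b≡1+j)))
               (count-cong (shift? (B? (suc j)) (caps zero)) (λ i → blockOf (caps ∘ suc) i ≟ᶠ j) (sum (caps ∘ suc))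
                           (λ _ 1≤i _ b≡1+j → Fin.suc-injective (trans (sym (blockOf-tail caps 1≤i)) b≡1+j))
                           (λ _ 1≤i _ b≡j → trans (blockOf-tail caps 1≤i) (cong suc b≡j))))
    (blockOf-count (caps ∘ suc) j)

blockOf-partialSum : ∀ {c} (caps : Fin (suc c) → ℕ) j {i} →
                     partialSum caps j < i → i ≤ partialSum caps j + caps j → blockOf caps i ≡ j
blockOf-partialSum {zero}  caps zero    _ _ = refl
blockOf-partialSum {suc c} caps zero    _ i≤caps₀ = blockOf-head caps i≤caps₀
blockOf-partialSum {suc c} caps (suc j) {i} lo hi = begin
  blockOf caps i                                  ≡⟨ cong (blockOf caps) (m+[n∸m]≡n caps₀≤i) ⟨
  blockOf caps (caps zero + (i ∸ caps zero))      ≡⟨ blockOf-tail caps (m<n⇒0<n∸m caps₀<i) ⟩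
  suc (blockOf (caps ∘ suc) (i ∸ caps zero))      ≡⟨ cong suc (blockOf-partialSum (caps ∘ suc) j lo′ hi′) ⟩
  suc j                                        ∎
  where
  open ≡-Reasoning
  caps₀<i = ≤-trans (s≤s (m≤m+n (caps zero) _)) lo
  caps₀≤i = <⇒≤ caps₀<i
  lo′ : partialSum (caps ∘ suc) j < i ∸ caps zero
  lo′ = +-cancelˡ-< (caps zero) _ _ (≤-trans lo (≤-reflexive (sym (m+[n∸m]≡n caps₀≤i))))
  hi′ : i ∸ caps zero ≤ partialSum (caps ∘ suc) j + caps (suc j)
  hi′ = +-cancelˡ-≤ (caps zero) _ _ (≤-trans (≤-reflexive (m+[n∸m]≡n caps₀≤i)) (≤-trans hi (≤-reflexive (+-assoc (caps zero) _ _))))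

differences : (ℕ → ℕ) → ∀ {n} → Fin n → ℕ
differences f j = f (suc (toℕ j)) ∸ f (toℕ j)

telescope-sum : ∀ n (f : ℕ → ℕ) → (∀ i → f i ≤ f (suc i)) → f 0 + sum {n} (differences f) ≡ f n
telescope-sum zero    f f-mono = +-identityʳ (f 0)
telescope-sum (suc n) f f-mono = begin
  f 0 + (f 1 ∸ f 0 + rest)      ≡⟨ +-assoc (f 0) _ rest ⟨
  f 0 + (f 1 ∸ f 0) + rest      ≡⟨ cong (_+ rest) (m+[n∸m]≡n (f-mono 0)) ⟩
  f 1 + rest                    ≡⟨ telescope-sum n (f ∘ suc) (f-mono ∘ suc) ⟩
  f (suc n)                     ∎
  where
  open ≡-Reasoning
  rest = sum {n} (differences (f ∘ suc))

telescope-partialSum : ∀ {n} (f : ℕ → ℕ) → (∀ i → f i ≤ f (suc i)) →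
                       (j : Fin n) → f 0 + partialSum (differences f) j ≡ f (toℕ j)
telescope-partialSum f f-mono zero    = +-identityʳ (f 0)
telescope-partialSum f f-mono (suc j) = begin
  f 0 + (f 1 ∸ f 0 + rest)      ≡⟨ +-assoc (f 0) _ rest ⟨
  f 0 + (f 1 ∸ f 0) + rest      ≡⟨ cong (_+ rest) (m+[n∸m]≡n (f-mono 0)) ⟩
  f 1 + rest                    ≡⟨ telescope-partialSum (f ∘ suc) (f-mono ∘ suc) j ⟩
  f (suc (toℕ j))               ∎
  where
  open ≡-Reasoning
  rest = partialSum (differences (f ∘ suc)) j

-- The construction

module Hubs (c : ℕ) .{{_ : NonZero c}} where

  N : ℕ
  N = 2 * c * c

  bound : ℕ → ℕ
  bound zero    = 0
  bound (suc j) = proj₁ (sieving-block N (bound j))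

  bound-mono : ∀ {i j} → i ≤ j → bound i ≤ bound j
  bound-mono {j = zero}  z≤n = ≤-refl
  bound-mono {i} {suc j} i≤1+j with i ≟ suc j
  ... | yes refl = ≤-refl
  ... | no i≢1+j = ≤-trans (bound-mono (≤-pred (≤∧≢⇒< i≤1+j i≢1+j))) (proj₁ (proj₂ (sieving-block N (bound j))))

  hub : Fin c → List ℕ
  hub j = primesIn (bound (toℕ j)) (bound (suc (toℕ j)))

  hubProduct : Fin c → ℕ
  hubProduct j = product (hub j)

  hubProduct-nonZero : ∀ j → NonZero (hubProduct j)
  hubProduct-nonZero j = productOfPrimes≢0 (primesIn-prime (bound (toℕ j)) (bound (suc (toℕ j))))

  hub-sieves : ∀ j → count (freeOf? (hub j)) (hubProduct j) * N ≤ hubProduct j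
  hub-sieves j = proj₂ (proj₂ (sieving-block N (bound (toℕ j))))

  count-hub-free : ∀ j x → count (freeOf? (hub j)) x * N ≤ x + N * hubProduct j
  count-hub-free j x = begin
    count (freeOf? (hub j)) x * N            ≤⟨ *-monoˡ-≤ N (count-periodic-≤ (freeOf? (hub j)) Q (free-+product⁻ _) (free-+product⁺ _) x) ⟩
    (x / Q * φ + Q) * N                      ≡⟨ solve 4 (λ a f q n → (a :* f :+ q) :* n := a :* (f :* n) :+ n :* q) refl (x / Q) φ Q N ⟩
    x / Q * (φ * N) + N * Q                  ≤⟨ +-monoˡ-≤ (N * Q) (*-monoʳ-≤ (x / Q) (hub-sieves j)) ⟩
    x / Q * Q + N * Q                        ≤⟨ +-monoˡ-≤ (N * Q) (m/n*n≤m x Q) ⟩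
    x + N * Q                                ∎
    where
    open ≤-Reasoning
    Q = hubProduct j
    φ = count (freeOf? (hub j)) Q
    instance _ = hubProduct-nonZero j

  -- A flexible number is divisible by a prime of every hub, so it can take any colour.
  Flex : Pred ℕ 0ℓ
  Flex n = ∀ j → ¬ FreeOf (hub j) n

  flex? : Decidable Flex
  flex? n = allᶠ? (λ j → ¬? (freeOf? (hub j) n))

  count-rigid-bound : ∀ x → 2 * c * sum hubProduct ≤ x → count (∁? flex?) x * c ≤ x
  count-rigid-bound x big = *-cancelˡ-≤ (2 * c) {{m*n≢0 2 c}} (begin
    2 * c * (R * c)                                     ≡⟨ solve 2 (λ r c → con 2 :* c :* (r :* c) := r :* (con 2 :* c :* c)) refl R c ⟩
    R * N                                               ≤⟨ *-monoˡ-≤ N (count-union-bound (∁? flex?) (freeOf? ∘ hub) some-hub-free x) ⟩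
    sum (λ j → count (freeOf? (hub j)) x) * N           ≡⟨ *-distribʳ-sum N (λ j → count (freeOf? (hub j)) x) ⟩
    sum (λ j → count (freeOf? (hub j)) x * N)           ≤⟨ sum-mono-≤ (λ j → count-hub-free j x) ⟩
    sum (λ j → x + N * hubProduct j)                    ≡⟨ ∑-distrib-+ (λ _ → x) (λ j → N * hubProduct j) ⟩
    sum {c} (λ _ → x) + sum (λ j → N * hubProduct j)    ≡⟨ cong₂ _+_ (sum-const c x) (sym (*-distribˡ-sum N hubProduct)) ⟩
    c * x + N * sum hubProduct
      ≡⟨ cong (c * x +_) (solve 2 (λ c s → con 2 :* c :* c :* s := c :* (con 2 :* c :* s)) refl c (sum hubProduct)) ⟩
    c * x + c * (2 * c * sum hubProduct)                ≤⟨ +-monoʳ-≤ (c * x) (*-monoʳ-≤ c big) ⟩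
    c * x + c * x                                       ≡⟨ solve 2 (λ c x → c :* x :+ c :* x := con 2 :* c :* x) refl c x ⟩
    2 * c * x                                           ∎)
    where
    open ≤-Reasoning
    R = count (∁? flex?) x
    some-hub-free : ∀ n → ¬ Flex n → ∃ λ j → FreeOf (hub j) n
    some-hub-free n ¬flex with ¬∀⟶∃¬ c (λ j → ¬ FreeOf (hub j) n) (λ j → ¬? (freeOf? (hub j) n)) ¬flex
    ... | j , ¬¬free = j , decidable-stable (freeOf? (hub j) n) ¬¬free

⌈/⌉≡/+1 : ∀ x c .{{_ : NonZero c}} → 1 ≤ x % c → ⌈ x / c ⌉ ≡ x / c + 1
⌈/⌉≡/+1 x c@(suc c₁) 1≤r = begin
  (x + c₁) / c                          ≡⟨ /-congˡ (cong (_+ c₁) (m≡m%n+[m/n]*n x c)) ⟩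
  (x % c + x / c * c + c₁) / c          ≡⟨ /-congˡ (xy∙z≈xz∙y (x % c) (x / c * c) c₁) ⟩
  (x % c + c₁ + x / c * c) / c          ≡⟨ +-distrib-/-∣ʳ (x % c + c₁) (n∣m*n (x / c)) ⟩
  (x % c + c₁) / c + x / c * c / c      ≡⟨ cong₂ _+_ ([r+c₁]/c≡1 (x % c) 1≤r (m%n<n x c)) (m*n/n≡m (x / c) c) ⟩
  1 + x / c                             ≡⟨ +-comm 1 (x / c) ⟩
  x / c + 1                             ∎
  where
  open ≡-Reasoning
  [r+c₁]/c≡1 : ∀ r → 1 ≤ r → r < c → (r + c₁) / c ≡ 1
  [r+c₁]/c≡1 (suc r) _ r<c = begin
    (suc r + c₁) / c     ≡⟨ /-congˡ (sym (+-suc r c₁)) ⟩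
    (r + c) / c          ≡⟨ +-distrib-/-∣ʳ r ∣-refl ⟩
    r / c + c / c        ≡⟨ cong₂ _+_ (m<n⇒m/n≡0 (<-trans (n<1+n r) r<c)) (n/n≡1 c) ⟩
    1                    ∎

module Construction (c₁ k : ℕ) where

  c : ℕ
  c = suc c₁

  open Hubs c

  M x : ℕ
  M = c * (k ∸ 1)
  x = p M ∸ 1

  hubSlots : Fin c → ℕ
  hubSlots = differences (ι ∘ bound)

  spareSlots : Fin c → ℕ
  spareSlots j = (k ∸ 1) ∸ hubSlots j

  -- The r-th slot (1 is the first, then the primes in increasing order) gets colour slotColour r:
  -- the slots up to bound c go to the colour of their hub, the remaining ones top every colour up to k - 1.
  slotColour : ℕ → Fin c
  slotColour r with r ≤? ι (bound c)
  ... | yes _ = blockOf hubSlots r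
  ... | no  _ = blockOf spareSlots (r ∸ ι (bound c))

  rigidColour : ℕ → Fin c
  rigidColour n = slotColour (ι (slotDivisor n))

  target : Fin c → ℕ
  target j = x / c + χ (toℕ j <? x % c)

  rigidCount : Fin c → ℕ
  rigidCount j = count (∁? flex? ∩? (λ i → rigidColour i ≟ᶠ j)) x

  flexQuota : Fin c → ℕ
  flexQuota j = target j ∸ rigidCount j

  -- Rigid numbers take the colour of a slot dividing them; flexible ones then top every
  -- class up to its target size.
  colour : ℕ → Fin c
  colour n with flex? n
  ... | yes _ = blockOf flexQuota (count flex? n)
  ... | no  _ = rigidColour n

  witness : ℕ → ℕ
  witness n with flex? n
  ... | yes _ = firstDivisor (hub (blockOf flexQuota (count flex? n))) n
  ... | no  _ = slotDivisor n

  colour-flex : ∀ {n} → Flex n → colour n ≡ blockOf flexQuota (count flex? n)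
  colour-flex {n} flex with flex? n
  ... | yes _    = refl
  ... | no ¬flex = ⊥-elim (¬flex flex)

  colour-rigid : ∀ {n} → ¬ Flex n → colour n ≡ rigidColour n
  colour-rigid {n} ¬flex with flex? n
  ... | yes flex = ⊥-elim (¬flex flex)
  ... | no _     = refl

  ιbound-mono : ∀ i → ι (bound i) ≤ ι (bound (suc i))
  ιbound-mono i = count-monoʳ-≤ slot? (bound-mono (n≤1+n i))

  partialSum-hubSlots : ∀ j → partialSum hubSlots j ≡ ι (bound (toℕ j))
  partialSum-hubSlots = telescope-partialSum (ι ∘ bound) ιbound-mono

  sum-hubSlots : sum hubSlots ≡ ι (bound c)
  sum-hubSlots = telescope-sum c (ι ∘ bound) ιbound-mono

  slotColour-hub : ∀ {r} → r ≤ ι (bound c) → slotColour r ≡ blockOf hubSlots r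
  slotColour-hub {r} r≤ with r ≤? ι (bound c)
  ... | yes _ = refl
  ... | no r≰ = ⊥-elim (r≰ r≤)

  slotColour-spare : ∀ {r} → 1 ≤ r → slotColour (ι (bound c) + r) ≡ blockOf spareSlots r
  slotColour-spare {r@(suc _)} _ with ι (bound c) + r ≤? ι (bound c)
  ... | yes ≤ι = ⊥-elim (m+1+n≰m (ι (bound c)) ≤ι)
  ... | no  _  = cong (blockOf spareSlots) (m+n∸m≡n (ι (bound c)) r)

  hub-slotColour : ∀ j {q} → Prime q → bound (toℕ j) < q → q ≤ bound (suc (toℕ j)) → slotColour (ι q) ≡ j
  hub-slotColour j {q@(suc q₁)} q-prime lo hi = trans (slotColour-hub ιq≤) (blockOf-partialSum hubSlots j below above)
    where
    ιq≤ : ι q ≤ ι (bound c)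
    ιq≤ = count-monoʳ-≤ slot? (≤-trans hi (bound-mono (toℕ<n j)))
    below : partialSum hubSlots j < ι q
    below = begin-strict
      partialSum hubSlots j    ≡⟨ partialSum-hubSlots j ⟩
      ι (bound (toℕ j))        ≤⟨ count-monoʳ-≤ slot? (≤-pred lo) ⟩
      ι q₁                     <⟨ ≤-reflexive (cong (_+ ι q₁) (sym (χ-yes (slot? q) (inj₁ q-prime)))) ⟩
      ι q                      ∎
      where open ≤-Reasoning
    above : ι q ≤ partialSum hubSlots j + hubSlots j
    above = begin
      ι q                                             ≤⟨ count-monoʳ-≤ slot? hi ⟩
      ι (bound (suc (toℕ j)))                         ≡⟨ m+[n∸m]≡n (ιbound-mono (toℕ j)) ⟨
      ι (bound (toℕ j)) + hubSlots j                  ≡⟨ cong (_+ hubSlots j) (partialSum-hubSlots j) ⟨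
      partialSum hubSlots j + hubSlots j              ∎
      where open ≤-Reasoning

  module Properties (k-large : bound c + 2 * c * sum hubProduct ≤ k ∸ 1) (2≤k : 2 ≤ k) where

    1≤k∸1 : 1 ≤ k ∸ 1
    1≤k∸1 = ∸-monoˡ-≤ 1 2≤k

    k∸1≤x : k ∸ 1 ≤ x
    k∸1≤x = ≤-trans (m≤m+n (k ∸ 1) (c₁ * (k ∸ 1))) (∸-monoˡ-≤ 1 (m<p M))

    ιx≡M : ι x ≡ M
    ιx≡M = ι-p∸1 M (≤-trans 1≤k∸1 (m≤m+n (k ∸ 1) _))

    bound-c≤k∸1 : bound c ≤ k ∸ 1
    bound-c≤k∸1 = ≤-trans (m≤m+n (bound c) _) k-large

    hubSlots≤k∸1 : ∀ j → hubSlots j ≤ k ∸ 1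
    hubSlots≤k∸1 j = begin
      ι (bound (suc (toℕ j))) ∸ ι (bound (toℕ j))   ≤⟨ m∸n≤m _ (ι (bound (toℕ j))) ⟩
      ι (bound (suc (toℕ j)))                       ≤⟨ count≤ slot? _ ⟩
      bound (suc (toℕ j))                           ≤⟨ bound-mono (toℕ<n j) ⟩
      bound c                                       ≤⟨ bound-c≤k∸1 ⟩
      k ∸ 1                                         ∎
      where open ≤-Reasoning

    ιbound-c≤M : ι (bound c) ≤ M
    ιbound-c≤M = ≤-trans (count-monoʳ-≤ slot? (≤-trans bound-c≤k∸1 k∸1≤x)) (≤-reflexive ιx≡M)

    sum-spareSlots : sum spareSlots ≡ M ∸ ι (bound c)
    sum-spareSlots = begin
      sum spareSlots                                      ≡⟨ m+n∸n≡m (sum spareSlots) (sum hubSlots) ⟨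
      sum spareSlots + sum hubSlots ∸ sum hubSlots        ≡⟨ cong₂ _∸_ (sum-∸ {c} (λ _ → k ∸ 1) hubSlots hubSlots≤k∸1) sum-hubSlots ⟩
      sum {c} (λ _ → k ∸ 1) ∸ ι (bound c)                 ≡⟨ cong (_∸ ι (bound c)) (sum-const c (k ∸ 1)) ⟩
      M ∸ ι (bound c)                                     ∎
      where open ≡-Reasoning

    slotColour-count : ∀ j → count (λ r → slotColour r ≟ᶠ j) M ≡ k ∸ 1
    slotColour-count j = begin
      count S? M                                                           ≡⟨ cong (count S?) (m+[n∸m]≡n ιbound-c≤M) ⟨
      count S? (ι (bound c) + (M ∸ ι (bound c)))                           ≡⟨ count-+ S? (ι (bound c)) _ ⟩
      count S? (ι (bound c)) + count (shift? S? (ι (bound c))) (M ∸ ι (bound c))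
        ≡⟨ cong₂ _+_ (count-cong S? (λ r → blockOf hubSlots r ≟ᶠ j) (ι (bound c)) (λ _ _ r≤ eq → trans (sym (slotColour-hub r≤)) eq)
                                                                  (λ _ _ r≤ eq → trans (slotColour-hub r≤) eq))
                     (count-cong (shift? S? (ι (bound c))) (λ r → blockOf spareSlots r ≟ᶠ j) (M ∸ ι (bound c))
                                 (λ _ 1≤r _ eq → trans (sym (slotColour-spare 1≤r)) eq)
                                 (λ _ 1≤r _ eq → trans (slotColour-spare 1≤r) eq)) ⟩
      count (λ r → blockOf hubSlots r ≟ᶠ j) (ι (bound c)) + count (λ r → blockOf spareSlots r ≟ᶠ j) (M ∸ ι (bound c))
        ≡⟨ cong₂ _+_ (trans (cong (count (λ r → blockOf hubSlots r ≟ᶠ j)) (sym sum-hubSlots)) (blockOf-count hubSlots j))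
                     (trans (cong (count (λ r → blockOf spareSlots r ≟ᶠ j)) (sym sum-spareSlots)) (blockOf-count spareSlots j)) ⟩
      hubSlots j + spareSlots j                                            ≡⟨ m+[n∸m]≡n (hubSlots≤k∸1 j) ⟩
      k ∸ 1                                                                ∎
      where
      open ≡-Reasoning
      S? = λ r → slotColour r ≟ᶠ j

    sum-target : sum target ≡ x
    sum-target = begin
      sum target                                               ≡⟨ ∑-distrib-+ {c} (λ _ → x / c) (λ j → χ (toℕ j <? x % c)) ⟩
      sum {c} (λ _ → x / c) + sum {c} (λ j → χ (toℕ j <? x % c))
        ≡⟨ cong₂ _+_ (sum-const c (x / c)) (sum-χ-< c (x % c) (<⇒≤ (m%n<n x c))) ⟩
      c * (x / c) + x % c                                      ≡⟨ trans (+-comm _ (x % c)) (cong (x % c +_) (*-comm c (x / c))) ⟩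
      x % c + x / c * c                                        ≡⟨ m≡m%n+[m/n]*n x c ⟨
      x                                                        ∎
      where open ≡-Reasoning

    count-rigid≤x/c : count (∁? flex?) x ≤ x / c
    count-rigid≤x/c = ≤-trans (≤-reflexive (sym (m*n/n≡m _ c)))
                              (/-monoˡ-≤ c (count-rigid-bound x (≤-trans (m≤n+m _ (bound c)) (≤-trans k-large k∸1≤x))))

    rigidCount≤target : ∀ j → rigidCount j ≤ target j
    rigidCount≤target j = ≤-trans (count-⊆ _ (∁? flex?) x (λ _ _ _ → proj₁)) (≤-trans count-rigid≤x/c (m≤m+n (x / c) _))

    sum-flexQuota : sum flexQuota ≡ count flex? x
    sum-flexQuota = +-cancelʳ-≡ (count (∁? flex?) x) (sum flexQuota) (count flex? x) (begin
      sum flexQuota + count (∁? flex?) x      ≡⟨ cong (sum flexQuota +_) (count-partition (∁? flex?) rigidColour x) ⟨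
      sum flexQuota + sum rigidCount          ≡⟨ sum-∸ target rigidCount rigidCount≤target ⟩
      sum target                              ≡⟨ sum-target ⟩
      x                                       ≡⟨ count+count-∁ flex? x ⟨
      count flex? x + count (∁? flex?) x      ∎)
      where open ≡-Reasoning

    colourClassSize : ∀ j → count (λ i → colour i ≟ᶠ j) x ≡ target j
    colourClassSize j = begin
      count C? x                                                              ≡⟨ count-∩∁ C? flex? x ⟩
      count (C? ∩? flex?) x + count (C? ∩? ∁? flex?) x
        ≡⟨ cong₂ _+_ (count-cong (C? ∩? flex?) (flex? ∩? (λ i → blockOf flexQuota (count flex? i) ≟ᶠ j)) x
                                 (λ _ _ _ (eq , flex) → flex , trans (sym (colour-flex flex)) eq)
                                 (λ _ _ _ (flex , eq) → trans (colour-flex flex) eq , flex))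
                     (count-cong (C? ∩? ∁? flex?) (∁? flex? ∩? (λ i → rigidColour i ≟ᶠ j)) x
                                 (λ _ _ _ (eq , ¬flex) → ¬flex , trans (sym (colour-rigid ¬flex)) eq)
                                 (λ _ _ _ (¬flex , eq) → trans (colour-rigid ¬flex) eq , ¬flex)) ⟩
      count (flex? ∩? (λ i → blockOf flexQuota (count flex? i) ≟ᶠ j)) x + rigidCount j
        ≡⟨ cong (_+ rigidCount j) (count-rank flex? (λ r → blockOf flexQuota r ≟ᶠ j) x) ⟩
      count (λ r → blockOf flexQuota r ≟ᶠ j) (count flex? x) + rigidCount j
        ≡⟨ cong (_+ rigidCount j) (trans (cong (count (λ r → blockOf flexQuota r ≟ᶠ j)) (sym sum-flexQuota)) (blockOf-count flexQuota j)) ⟩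
      flexQuota j + rigidCount j                                              ≡⟨ m∸n+n≡m (rigidCount≤target j) ⟩
      target j                                                                ∎
      where
      open ≡-Reasoning
      C? = λ i → colour i ≟ᶠ j

    balanced : Balanced c x colour
    balanced j with toℕ j <? x % c
    ... | yes j<r = inj₂ (begin
      classSize colour x j     ≡⟨ length-filter-oneTo (λ i → colour i ≟ᶠ j) x ⟩
      count (λ i → colour i ≟ᶠ j) x ≡⟨ colourClassSize j ⟩
      x / c + χ (toℕ j <? x % c)    ≡⟨ cong (x / c +_) (χ-yes (toℕ j <? x % c) j<r) ⟩
      x / c + 1                     ≡⟨ ⌈/⌉≡/+1 x c (≤-trans (s≤s z≤n) j<r) ⟨
      ⌈ x / c ⌉                     ∎)
      where open ≡-Reasoning
    ... | no j≮r = inj₁ (begin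
      classSize colour x j     ≡⟨ length-filter-oneTo (λ i → colour i ≟ᶠ j) x ⟩
      count (λ i → colour i ≟ᶠ j) x ≡⟨ colourClassSize j ⟩
      x / c + χ (toℕ j <? x % c)    ≡⟨ cong (x / c +_) (χ-no (toℕ j <? x % c) j≮r) ⟩
      x / c + 0                     ≡⟨ +-identityʳ (x / c) ⟩
      x / c                         ∎)
      where open ≡-Reasoning

    SlotOfColour : Fin c → Pred ℕ 0ℓ
    SlotOfColour j s = Slot s × slotColour (ι s) ≡ j

    witness-witnesses : ∀ {a} → 1 ≤ a → Witnessed witness (SlotOfColour (colour a)) a
    witness-witnesses {a} 1≤a with flex? a
    ... | yes flex = q∣a , (λ q≡1 → ⊥-elim (<-irrefl (sym q≡1) (prime≥2 q-prime))) , inj₁ q-prime , hub-slotColour j q-prime lo hi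
      where
      j = blockOf flexQuota (count flex? a)
      found = firstDivisor-spec (hub j) a (primesIn-sound _ _) (flex j)
      q-prime = proj₁ (proj₁ found)
      lo = proj₁ (proj₂ (proj₁ found))
      hi = proj₂ (proj₂ (proj₁ found))
      q∣a = proj₂ found
    ... | no _ with slotDivisor-witnesses 1≤a
    ...   | d∣a , d≡1⇒a≡1 , d-slot = d∣a , d≡1⇒a≡1 , d-slot , refl

    coprime-free : ∀ j → ¬ ClassHasCoprimeK colour x j k
    coprime-free j (xs , length≡k , members , pairwise) = 1+n≰n (begin
      suc (k ∸ 1)                                               ≡⟨ m+[n∸m]≡n (≤-trans (s≤s z≤n) 2≤k) ⟩
      k                                                         ≡⟨ length≡k ⟨
      length xs                                                 ≤⟨ coprime-length≤count witness (slot? ∩? (λ s → slotColour (ι s) ≟ᶠ j)) x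
                                                                     (All.map witnessed members) pairwise ⟩
      count (slot? ∩? (λ s → slotColour (ι s) ≟ᶠ j)) x          ≡⟨ count-rank slot? (λ r → slotColour r ≟ᶠ j) x ⟩
      count (λ r → slotColour r ≟ᶠ j) (ι x)                     ≡⟨ cong (count (λ r → slotColour r ≟ᶠ j)) ιx≡M ⟩
      count (λ r → slotColour r ≟ᶠ j) M                         ≡⟨ slotColour-count j ⟩
      k ∸ 1                                                     ∎)
      where
      open ≤-Reasoning
      witnessed : ∀ {a} → 1 ≤ a × a ≤ x × colour a ≡ j → 1 ≤ a × a ≤ x × Witnessed witness (SlotOfColour j) a
      witnessed (1≤a , a≤x , refl) = 1≤a , a≤x , witness-witnesses 1≤a

theorem7p1 : (c : ℕ) → .{{_ : NonZero c}} → 2 ≤ c →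
    Σ ℕ λ K → (k : ℕ) → K ≤ k →
      AdmitsBal k c (p (c * (k ∸ 1)) ∸ 1)
      × ((n : ℕ) → AdmitsBal k c n → n ≤ p (c * (k ∸ 1)) ∸ 1)
theorem7p1 c@(suc c₁) (s≤s _) = K , λ k K≤k → lower-bound k K≤k , upper-bound k K≤k
  where
  open Hubs c using (bound; hubProduct)
  X = bound c + 2 * c * sum hubProduct
  K = 2 + X
  lower-bound : ∀ k → K ≤ k → AdmitsBal k c (p (c * (k ∸ 1)) ∸ 1)
  lower-bound k K≤k = colour , balanced , coprime-free
    where
    open Construction c₁ k using (colour; module Properties)
    open Properties (≤-trans (n≤1+n X) (∸-monoˡ-≤ 1 K≤k)) (≤-trans (m≤m+n 2 X) K≤k)
  upper-bound : ∀ k → K ≤ k → (n : ℕ) → AdmitsBal k c n → n ≤ p (c * (k ∸ 1)) ∸ 1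
  upper-bound k K≤k n (col , _ , coprime-free) = coprime-free⇒≤ k n col (≤-trans (s≤s z≤n) K≤k) coprime-free
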